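{- Let $\pi$ be an ordering of $n$ agents and $x$ a 1D-mobility schedule from $\pi$ such that $\mathcal{G}_{\pi,x}=((V,E),\lambda)$ is a temporal clique. Then $\pi$ excludes the four forbidden ordered patterns: for any three agents $a,b,c$ appearing in this order in $\pi$, $\lambda(ac)$ is the median of $\{\lambda(ab),\lambda(ac),\lambda(bc)\}$.
   Context: 1D-mobility model: $n$ agents lie on a line in an initial ordering $\pi$ (a sequence listing all agents). A 1D-mobility schedule from $\pi$ is a sequence $x=(x_1,\dots,x_T)$ of pairs of agents, where, setting $\pi_0=\pi$, each $x_t=\{u,v\}$ consists of two agents that are consecutive in $\pi_{t-1}$, and $\pi_t$ is obtained from $\pi_{t-1}$ by exchanging $u$ and $v$. The temporal graph $\mathcal{G}_{\pi,x}$ has vertex set the agents and an edge $uv$ with label $\lambda(uv)=t$ whenever $x_t=uv$. It is a temporal clique when every pair of agents appears in exactly one $x_t$ (so each edge of the complete graph has a single label, labels being pairwise distinct). The four forbidden ordered patterns of an ordering are the ordered triangles $a,b,c$ (in this order) in which $\lambda(ac)$ is the smallest or the largest of the three labels $\lambda(ab),\lambda(ac),\lambda(bc)$. -}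

module Defs where

open import Data.Nat using (ℕ)
open import Data.Fin using (Fin; _<_)
open import Data.List using (List; []; _∷_; _++_; length; lookup; allFin)
open import Data.List.Relation.Binary.Permutation.Propositional using (_↭_)
open import Data.Product using (Σ; _×_; _,_)
open import Data.Sum using (_⊎_)
open import Relation.Binary.PropositionalEquality using (_≡_; _≢_)

-- Agents are Fin n.  An ordering of the n agents is a list that is a
-- permutation of all agents (left-to-right order on the line).
Agent : ℕ → Set
Agent n = Fin n

IsOrdering : (n : ℕ) → List (Agent n) → Set
IsOrdering n π = π ↭ allFin n

data Step {A : Set} : List A → A × A → List A → Set where
  swap-uv : (pre suf : List A) (u v : A) →
            Step (pre ++ u ∷ v ∷ suf) (u , v) (pre ++ v ∷ u ∷ suf)
  swap-vu : (pre suf : List A) (u v : A) →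
            Step (pre ++ v ∷ u ∷ suf) (u , v) (pre ++ u ∷ v ∷ suf)

data Schedule {A : Set} : List A → List (A × A) → Set where
  done : {π : List A} → Schedule π []
  step : {π π' : List A} {p : A × A} {xs : List (A × A)} →
         Step π p π' → Schedule π' xs → Schedule π (p ∷ xs)

-- The t-th entry of x (t is the time step, 0-based) is the pair {u,v}.
-- So "λ(uv) = t" (up to the shift by one) is  HasLabel x u v t.
HasLabel : {A : Set} (x : List (A × A)) → A → A → Fin (length x) → Set
HasLabel x u v t = lookup x t ≡ (u , v) ⊎ lookup x t ≡ (v , u)

IsTemporalClique : (n : ℕ) → List (Agent n × Agent n) → Set
IsTemporalClique n x =
  (u v : Agent n) → u ≢ v →
  Σ (Fin (length x)) λ t → HasLabel x u v t ×
    ((t' : Fin (length x)) → HasLabel x u v t' → t' ≡ t)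

InOrder : {A : Set} → List A → A → A → A → Set
InOrder π a b c =
  Σ (Fin (length π)) λ i → Σ (Fin (length π)) λ j → Σ (Fin (length π)) λ k →
    i < j × j < k × lookup π i ≡ a × lookup π j ≡ b × lookup π k ≡ c

IsMedian : {m : ℕ} → Fin m → Fin m → Fin m → Set
IsMedian tab tac tbc = (tab < tac × tac < tbc) ⊎ (tbc < tac × tac < tab)

-- Only the swap of {a, c} changes the relative order of a and c, so just before
-- time λ(ac) the agents a and c are still in their initial order and adjacent.
-- If λ(ab) and λ(bc) were both later, b would still lie strictly between a and c
-- there, contradicting adjacency; if both were earlier, b would already precede a
-- and c precede b, contradicting that a precedes c.
module Submission where

open import Defs
open import Data.Nat using (ℕ)
open import Data.Fin using (Fin)
open import Data.List using (List; length)
open import Data.Product using (_×_)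

open import Data.Nat using (z<s; s<s)
open import Data.Fin using (zero; suc; _<_)
open import Data.Fin.Properties using (<-cmp; <-trans; <-irrefl; suc-injective; 0≢1+n)
open import Data.List using ([]; _∷_; _++_; lookup)
open import Data.List.Membership.Propositional using (_∈_)
open import Data.List.Membership.Propositional.Properties using (∈-lookup)
open import Data.List.Relation.Unary.Any using (here; there)
open import Data.List.Relation.Unary.All.Properties using (All¬⇒¬Any)
open import Data.List.Relation.Unary.AllPairs using ([]; _∷_)
open import Data.List.Relation.Unary.Unique.Propositional using (Unique)
open import Data.List.Relation.Unary.Unique.Propositional.Properties using (allFin⁺)
open import Data.List.Relation.Binary.Permutation.Propositional using (_↭_; ↭-refl; ↭-sym; ↭-swap; ↭⇒↭ₛ)
open import Data.List.Relation.Binary.Permutation.Propositional.Properties using (∈-resp-↭; ++⁺ˡ)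
import Data.List.Relation.Binary.Permutation.Setoid.Properties as Setoid↭
open import Data.Product using (Σ; ∃₂; _,_; proj₁; proj₂)
open import Data.Sum using (_⊎_; inj₁; inj₂)
import Data.Sum as Sum
open import Data.Empty using (⊥-elim)
open import Relation.Nullary using (¬_)
open import Relation.Binary using (tri<; tri≈; tri>)
open import Relation.Binary.PropositionalEquality using (_≡_; _≢_; refl; sym; trans; subst; setoid)
open import Function using (_∘_)

module _ {A : Set} where

  Unique-resp-↭ : {xs ys : List A} → xs ↭ ys → Unique xs → Unique ys
  Unique-resp-↭ p = Setoid↭.Unique-resp-↭ (setoid A) (↭⇒↭ₛ p)

  data Before : List A → A → A → Set where
    first : ∀ {u v xs} → v ∈ xs → Before (u ∷ xs) u v
    skip  : ∀ {u v y xs} → Before xs u v → Before (y ∷ xs) u v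

  Before⇒∈ˡ : ∀ {xs u v} → Before xs u v → u ∈ xs
  Before⇒∈ˡ (first _) = here refl
  Before⇒∈ˡ (skip b)  = there (Before⇒∈ˡ b)

  Before⇒∈ʳ : ∀ {xs u v} → Before xs u v → v ∈ xs
  Before⇒∈ʳ (first v∈) = there v∈
  Before⇒∈ʳ (skip b)   = there (Before⇒∈ʳ b)

  Before-asym : ∀ {xs u v} → Unique xs → Before xs u v → ¬ Before xs v u
  Before-asym (u∉ ∷ _) (first _) (first v∈) = All¬⇒¬Any u∉ v∈
  Before-asym (u∉ ∷ _) (first _) (skip vu)  = All¬⇒¬Any u∉ (Before⇒∈ʳ vu)
  Before-asym (v∉ ∷ _) (skip uv) (first _)  = All¬⇒¬Any v∉ (Before⇒∈ʳ uv)
  Before-asym (_ ∷ un) (skip uv) (skip vu)  = Before-asym un uv vu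

  Before-irrefl : ∀ {xs u v} → Unique xs → Before xs u v → u ≢ v
  Before-irrefl un uv refl = Before-asym un uv uv

  Before-trans : ∀ {xs u v w} → Unique xs → Before xs u v → Before xs v w → Before xs u w
  Before-trans (u∉ ∷ _) (first v∈) (first _) = ⊥-elim (All¬⇒¬Any u∉ v∈)
  Before-trans _        (first _)  (skip vw) = first (Before⇒∈ʳ vw)
  Before-trans (v∉ ∷ _) (skip uv)  (first _) = ⊥-elim (All¬⇒¬Any v∉ (Before⇒∈ʳ uv))
  Before-trans (_ ∷ un) (skip uv)  (skip vw) = skip (Before-trans un uv vw)

  Before-++⁺ʳ : ∀ pre {xs u v} → Before xs u v → Before (pre ++ xs) u v
  Before-++⁺ʳ []        b = b
  Before-++⁺ʳ (_ ∷ pre) b = skip (Before-++⁺ʳ pre b)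

  Before-lookup : ∀ (xs : List A) {i j} → i < j → Before xs (lookup xs i) (lookup xs j)
  Before-lookup (_ ∷ xs) {zero}  {suc j} _         = first (∈-lookup j)
  Before-lookup (_ ∷ xs) {suc i} {suc j} (s<s i<j) = skip (Before-lookup xs i<j)

  Before-adjacent : ∀ pre {u v suf} → Before (pre ++ u ∷ v ∷ suf) u v
  Before-adjacent pre = Before-++⁺ʳ pre (first (here refl))

  ∈-middle : ∀ (pre : List A) {u suf} → u ∈ pre ++ u ∷ suf
  ∈-middle []        = here refl
  ∈-middle (_ ∷ pre) = there (∈-middle pre)

  Before-successor : ∀ pre {u v w suf} → let xs = pre ++ u ∷ v ∷ suf in
                     Unique xs → Before xs u w → w ≡ v ⊎ Before xs v w
  Before-successor []        _        (first (here refl)) = inj₁ refl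
  Before-successor []        _        (first (there w∈))  = inj₂ (skip (first w∈))
  Before-successor []        (u∉ ∷ _) (skip vw)           = ⊥-elim (All¬⇒¬Any u∉ (Before⇒∈ˡ vw))
  Before-successor (_ ∷ pre) (y∉ ∷ _) (first _)           = ⊥-elim (All¬⇒¬Any y∉ (∈-middle pre))
  Before-successor (_ ∷ pre) (_ ∷ un) (skip uw)           = Sum.map₂ skip (Before-successor pre un uw)

  ¬Before-between : ∀ pre {u v w suf} → let xs = pre ++ u ∷ v ∷ suf in
                    Unique xs → Before xs u w → ¬ Before xs w v
  ¬Before-between pre un uw wv with Before-successor pre un uw
  ... | inj₁ refl = Before-irrefl un wv refl
  ... | inj₂ vw   = Before-asym un vw wv

  Before-swap-other : ∀ pre {u v suf s t} → Before (pre ++ u ∷ v ∷ suf) s t →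
                      ¬ (s ≡ u × t ≡ v) → Before (pre ++ v ∷ u ∷ suf) s t
  Before-swap-other []        (first (here refl)) ne = ⊥-elim (ne (refl , refl))
  Before-swap-other []        (first (there t∈))  _  = skip (first t∈)
  Before-swap-other []        (skip (first t∈))   _  = first (there t∈)
  Before-swap-other []        (skip (skip st))    _  = skip (skip st)
  Before-swap-other (_ ∷ pre) (first t∈)          _  = first (∈-resp-↭ (++⁺ˡ pre (↭-swap _ _ ↭-refl)) t∈)
  Before-swap-other (_ ∷ pre) (skip st)           ne = skip (Before-swap-other pre st ne)

  SamePair : A × A → A → A → Set
  SamePair p u v = p ≡ (u , v) ⊎ p ≡ (v , u)

  SamePair-cancelˡ : ∀ {p u v w} → SamePair p u v → SamePair p u w → u ≢ w → v ≡ w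
  SamePair-cancelˡ (inj₁ refl) (inj₁ refl) _   = refl
  SamePair-cancelˡ (inj₁ refl) (inj₂ refl) u≢w = ⊥-elim (u≢w refl)
  SamePair-cancelˡ (inj₂ refl) (inj₁ refl) u≢w = ⊥-elim (u≢w refl)
  SamePair-cancelˡ (inj₂ refl) (inj₂ refl) _   = refl

  Step⇒↭ : ∀ {xs p ys} → Step {A} xs p ys → xs ↭ ys
  Step⇒↭ (swap-uv pre _ _ _) = ++⁺ˡ pre (↭-swap _ _ ↭-refl)
  Step⇒↭ (swap-vu pre _ _ _) = ++⁺ˡ pre (↭-swap _ _ ↭-refl)

  Step-preserves-Before : ∀ {xs p ys u v} → Step {A} xs p ys → Before xs u v →
                          ¬ SamePair p u v → Before ys u v
  Step-preserves-Before (swap-uv pre _ _ _) uv ne =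
    Before-swap-other pre uv λ { (refl , refl) → ne (inj₁ refl) }
  Step-preserves-Before (swap-vu pre _ _ _) uv ne =
    Before-swap-other pre uv λ { (refl , refl) → ne (inj₂ refl) }

  Step-adjacent : ∀ {xs p ys u v} → Unique xs → Step {A} xs p ys → SamePair p u v → Before xs u v →
                  ∃₂ λ pre suf → xs ≡ pre ++ u ∷ v ∷ suf × ys ≡ pre ++ v ∷ u ∷ suf
  Step-adjacent _  (swap-uv pre suf _ _) (inj₁ refl) _  = pre , suf , refl , refl
  Step-adjacent un (swap-uv pre _ _ _)   (inj₂ refl) uv = ⊥-elim (Before-asym un uv (Before-adjacent pre))
  Step-adjacent un (swap-vu pre _ _ _)   (inj₁ refl) uv = ⊥-elim (Before-asym un uv (Before-adjacent pre))
  Step-adjacent _  (swap-vu pre suf _ _) (inj₂ refl) _  = pre , suf , refl , refl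

  Step-reverses-Before : ∀ {xs p ys u v} → Unique xs → Step {A} xs p ys → SamePair p u v →
                         Before xs u v → Before ys v u
  Step-reverses-Before un st same uv with Step-adjacent un st same uv
  ... | pre , _ , refl , refl = Before-adjacent pre

  Step-¬between : ∀ {xs p ys u v w} → Unique xs → Step {A} xs p ys → SamePair p u v →
                  Before xs u v → Before xs u w → ¬ Before xs w v
  Step-¬between un st same uv with Step-adjacent un st same uv
  ... | pre , _ , refl , _ = ¬Before-between pre un

  -- The ordering just before the step x_t is performed.
  orderingAt : ∀ {π x} → Schedule {A} π x → Fin (length x) → List A
  orderingAt {π} (step _ _)   zero    = π
  orderingAt     (step _ sch) (suc t) = orderingAt sch t

  stepAt : ∀ {π x} (sch : Schedule {A} π x) t → Σ (List A) (Step (orderingAt sch t) (lookup x t))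
  stepAt (step st _)   zero    = _ , st
  stepAt (step _ sch)  (suc t) = stepAt sch t

  Unique-orderingAt : ∀ {π x} (sch : Schedule {A} π x) t → Unique π → Unique (orderingAt sch t)
  Unique-orderingAt (step _ _)    zero    un = un
  Unique-orderingAt (step st sch) (suc t) un = Unique-orderingAt sch t (Unique-resp-↭ (Step⇒↭ st) un)

  Before-orderingAt-unswapped : ∀ {π x u v} (sch : Schedule {A} π x) T → Before π u v →
    (∀ t → t < T → ¬ HasLabel x u v t) → Before (orderingAt sch T) u v
  Before-orderingAt-unswapped (step _ _)    zero    uv _      = uv
  Before-orderingAt-unswapped (step st sch) (suc T) uv never =
    Before-orderingAt-unswapped sch T (Step-preserves-Before st uv (never zero z<s))
      λ t t<T → never (suc t) (s<s t<T)

  Before-orderingAt-swapped : ∀ {π x u v} (sch : Schedule {A} π x) T {t₀} → Unique π → Before π u v →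
    HasLabel x u v t₀ → t₀ < T → (∀ t → t < T → HasLabel x u v t → t ≡ t₀) →
    Before (orderingAt sch T) v u
  Before-orderingAt-swapped (step st sch) (suc T) {zero} un uv swapped _ only =
    Before-orderingAt-unswapped sch T (Step-reverses-Before un st swapped uv)
      λ t t<T vu → 0≢1+n (sym (only (suc t) (s<s t<T) (Sum.swap vu)))
  Before-orderingAt-swapped (step st sch) (suc T) {suc t₀} un uv swapped (s<s t₀<T) only =
    Before-orderingAt-swapped sch T (Unique-resp-↭ (Step⇒↭ st) un)
      (Step-preserves-Before st uv λ same → 0≢1+n (only zero z<s same)) swapped t₀<T
      λ t t<T same → suc-injective (only (suc t) (s<s t<T) same)

IsMedian-intro : ∀ {m} {r s t : Fin m} → r ≢ s → t ≢ s →
                 ¬ (r < s × t < s) → ¬ (s < r × s < t) → IsMedian r s t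
IsMedian-intro r≢s t≢s ¬earlier ¬later with <-cmp _ _ | <-cmp _ _
... | tri≈ _ r≡s _ | _            = ⊥-elim (r≢s r≡s)
... | _            | tri≈ _ t≡s _ = ⊥-elim (t≢s t≡s)
... | tri< r<s _ _ | tri> _ _ s<t = inj₁ (r<s , s<t)
... | tri> _ _ s<r | tri< t<s _ _ = inj₂ (t<s , s<r)
... | tri< r<s _ _ | tri< t<s _ _ = ⊥-elim (¬earlier (r<s , t<s))
... | tri> _ _ s<r | tri> _ _ s<t = ⊥-elim (¬later (s<r , s<t))

InOrder⇒Before : ∀ {A : Set} {π : List A} {a b c} → InOrder π a b c → Before π a b × Before π b c
InOrder⇒Before {π = π} (_ , _ , _ , i<j , j<k , refl , refl , refl) =
  Before-lookup π i<j , Before-lookup π j<k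

IsOrdering⇒Unique : ∀ {n π} → IsOrdering n π → Unique π
IsOrdering⇒Unique {n} ord = Unique-resp-↭ (↭-sym ord) (allFin⁺ n)

IsTemporalClique⇒HasLabel-unique : ∀ {n x u v t t'} → IsTemporalClique n x → u ≢ v →
  HasLabel x u v t → HasLabel x u v t' → t' ≡ t
IsTemporalClique⇒HasLabel-unique {u = u} {v} {t} {t'} clique u≢v hasT hasT'
  with clique u v u≢v
... | _ , _ , only = trans (only t' hasT') (sym (only t hasT))

mainTheorem2 : (n : ℕ) (π : List (Agent n)) (x : List (Agent n × Agent n)) →
    IsOrdering n π → Schedule π x → IsTemporalClique n x →
    (a b c : Agent n) → InOrder π a b c →
    (tab tac tbc : Fin (length x)) →
    HasLabel x a b tab → HasLabel x a c tac → HasLabel x b c tbc →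
    IsMedian tab tac tbc
mainTheorem2 n π x ord sch clique a b c abc tab tac tbc hab hac hbc =
  IsMedian-intro
    (λ { refl → Before-irrefl unique bc (SamePair-cancelˡ hab hac (Before-irrefl unique ac)) })
    (λ { refl → Before-irrefl unique ab
                  (sym (SamePair-cancelˡ (Sum.swap hbc) (Sum.swap hac) (Before-irrefl unique ac ∘ sym))) })
    (λ (ab<ac , bc<ac) → Before-asym unique-now ac-now
                           (Before-trans unique-now (earlier bc hbc bc<ac) (earlier ab hab ab<ac)))
    (λ (ac<ab , ac<bc) → Step-¬between unique-now (proj₂ (stepAt sch tac)) hac ac-now
                           (later ab hab ac<ab) (later bc hbc ac<bc))
  where
  unique : Unique π
  unique = IsOrdering⇒Unique ord
  ab : Before π a b
  ab = proj₁ (InOrder⇒Before abc)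
  bc : Before π b c
  bc = proj₂ (InOrder⇒Before abc)
  ac : Before π a c
  ac = Before-trans unique ab bc
  only : ∀ {u v t t'} → Before π u v → HasLabel x u v t → HasLabel x u v t' → t' ≡ t
  only uv = IsTemporalClique⇒HasLabel-unique {x = x} clique (Before-irrefl unique uv)
  now : List (Agent n)
  now = orderingAt sch tac
  unique-now : Unique now
  unique-now = Unique-orderingAt sch tac unique
  ac-now : Before now a c
  ac-now = Before-orderingAt-unswapped sch tac ac λ t t<ac h → <-irrefl (only ac hac h) t<ac
  earlier : ∀ {u v t} → Before π u v → HasLabel x u v t → t < tac → Before now v u
  earlier uv h t<ac = Before-orderingAt-swapped sch tac unique uv h t<ac λ _ _ h' → only uv h h'
  later : ∀ {u v t} → Before π u v → HasLabel x u v t → tac < t → Before now u v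
  later uv h ac<t = Before-orderingAt-unswapped sch tac uv
    λ t' t'<ac h' → <-irrefl refl (<-trans ac<t (subst (_< tac) (only uv h h') t'<ac))
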